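{- Let $\tau=(\vec S,\le,{}^*)$ be a regular tree set. Let $X\subseteq\vec S$ be antisymmetric and such that $(X,\le)$ is an order tree $T$. If $X^*=\{x^*:x\in X\}$ is consistent in $\tau$, then the ordering and involution that $\tau$ induces on $X\cup X^*$ coincide with those of $\tau(T)$ (where $X^*$ with the involution of $\tau$ serves as the set of added inverses).
   Context: A separation system is a poset with an order-reversing involution ${}^*$; write $\overleftarrow s=\vec s^{\,*}$, $s=\{\vec s,\overleftarrow s\}$. $\vec s$ is degenerate if $\vec s=\overleftarrow s$, small if $\vec s\le\overleftarrow s$, trivial if there is a separation $t$ with $\vec s<\vec t$ and $\vec s<\overleftarrow t$. Regular: no small elements; essential: no trivial, no degenerate elements; nested: any two separations have comparable orientations; a tree set is a nested essential separation system. A set $O\subseteq\vec S$ is antisymmetric if it contains at most one of $\vec s,\overleftarrow s$ for every separation $s$ (apart from degenerate ones); it is consistent if there are no distinct separations $r\ne s$ with orientations $\vec r<\vec s$ and $\overleftarrow r,\vec s\in O$. An order tree is a poset in which the set of elements below any element is a chain. For an order tree $T=(X,\le)$, $\tau(T)$ is $X\cup X^*$ (with $X^*$ a disjoint copy $\{x^*\}$) ordered by keeping the order of $X$, $x^*<y^*$ iff $x>y$ in $T$, $x^*<y$ iff $x,y$ incomparable in $T$, and no further relations, with involution $x\leftrightarrow x^*$. -}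

module Defs where

open import Level using (Level; _⊔_) renaming (suc to lsuc)
open import Data.Product using (Σ; Σ-syntax; ∃; _×_; _,_; proj₁)
open import Data.Sum using (_⊎_; inj₁; inj₂)
open import Data.Empty using (⊥)
open import Relation.Nullary using (¬_)
open import Relation.Unary using (Pred)
open import Relation.Binary.PropositionalEquality using (_≡_; _≢_)
open import Relation.Binary.Structures using (IsPartialOrder)

record SepSys (c ℓ : Level) : Set (lsuc (c ⊔ ℓ)) where
  infix 4 _≤_
  infix 8 _*
  field
    Carrier        : Set c
    _≤_            : Carrier → Carrier → Set ℓ
    isPartialOrder : IsPartialOrder _≡_ _≤_
    _*             : Carrier → Carrier
    *-involutive   : ∀ a → (a *) * ≡ a
    *-reversing    : ∀ {a b} → a ≤ b → b * ≤ a *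

module _ {c ℓ : Level} (S : SepSys c ℓ) where
  open SepSys S

  infix 4 _<_
  _<_ : Carrier → Carrier → Set (c ⊔ ℓ)
  a < b = (a ≤ b) × (a ≢ b)

  Comparable : Carrier → Carrier → Set ℓ
  Comparable a b = (a ≤ b) ⊎ (b ≤ a)

  -- the unoriented separations of a and b coincide: {a, a*} = {b, b*}
  SameSep : Carrier → Carrier → Set c
  SameSep a b = (a ≡ b) ⊎ (a ≡ b *)

  Degenerate : Carrier → Set c
  Degenerate a = a ≡ a *

  Small : Carrier → Set ℓ
  Small a = a ≤ a *

  Trivial : Carrier → Set (c ⊔ ℓ)
  Trivial a = Σ[ t ∈ Carrier ] ((a < t) × (a < t *))

  Regular : Set (c ⊔ ℓ)
  Regular = ∀ a → ¬ Small a

  Essential : Set (c ⊔ ℓ)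
  Essential = (∀ a → ¬ Trivial a) × (∀ a → ¬ Degenerate a)

  NestedPair : Carrier → Carrier → Set ℓ
  NestedPair a b = Comparable a b ⊎ Comparable a (b *)
                 ⊎ Comparable (a *) b ⊎ Comparable (a *) (b *)

  Nested : Set (c ⊔ ℓ)
  Nested = ∀ a b → NestedPair a b

  TreeSet : Set (c ⊔ ℓ)
  TreeSet = Nested × Essential

  module _ {ℓx : Level} (X : Pred Carrier ℓx) where

    Antisymmetric : Set (c ⊔ ℓx)
    Antisymmetric = ∀ a → X a → X (a *) → Degenerate a

    Consistent : Set (c ⊔ ℓ ⊔ ℓx)
    Consistent = ∀ r s → ¬ SameSep r s → r < s → X (r *) → X s → ⊥

    IsOrderTree : Set (c ⊔ ℓ ⊔ ℓx)
    IsOrderTree = ∀ {x y z} → X x → X y → X z → y ≤ x → z ≤ x → Comparable y z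

    Star : Pred Carrier (c ⊔ ℓx)
    Star a = Σ[ x ∈ Carrier ] (X x × (a ≡ x *))

    Elt : Set (c ⊔ ℓx)
    Elt = Σ Carrier X

    -- underlying set of τ(T): X ⊎ X*, with inj₁ x = x and inj₂ x = x*
    τElt : Set (c ⊔ ℓx)
    τElt = Elt ⊎ Elt

    τ≤ : τElt → τElt → Set (c ⊔ ℓ)
    τ≤ (inj₁ x) (inj₁ y) = Level.Lift c (proj₁ x ≤ proj₁ y)
    τ≤ (inj₂ x) (inj₂ y) = Level.Lift c (proj₁ y ≤ proj₁ x)
    τ≤ (inj₂ x) (inj₁ y) = Level.Lift c (¬ Comparable (proj₁ x) (proj₁ y))
    τ≤ (inj₁ x) (inj₂ y) = Level.Lift (c ⊔ ℓ) ⊥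

    τ* : τElt → τElt
    τ* (inj₁ x) = inj₂ x
    τ* (inj₂ x) = inj₁ x

    embed : τElt → Carrier
    embed (inj₁ x) = proj₁ x
    embed (inj₂ x) = proj₁ x *

module Submission where

-- The involutions agree because * is involutive.  For the order we
-- compare the four kinds of pairs:
--   * x ≤ y  and  x* ≤ y*  : the orders agree, since * is an order-reversing
--     involution (so x* ≤ y* iff y ≤ x);
--   * x ≤ y*               : never holds, since consistency of X* together with
--     antisymmetry of X, regularity and non-degeneracy forbids it;
--   * x* ≤ y               : by regularity this forces x, y to be incomparable,
--     and conversely, if x, y are incomparable then nestedness leaves x* ≤ y
--     as the only possible relation between orientations of x and y.

open import Defs
open import Level using (Level; lift; lower)
open import Data.Product using (_×_; _,_; proj₁)
open import Data.Sum using (inj₁; inj₂)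
open import Data.Empty using (⊥-elim)
open import Relation.Nullary using (¬_)
open import Relation.Unary using (Pred)
open import Relation.Binary.PropositionalEquality using (_≡_; refl; sym; trans; subst)
open import Relation.Binary.Structures using (IsPartialOrder)
open import Function.Bundles using (_⇔_; mk⇔)

module SeparationFacts {c ℓ : Level} (S : SepSys c ℓ) where
  open SepSys S
  open IsPartialOrder isPartialOrder using () renaming (trans to ≤-trans)

  *-reflecting : ∀ {a b} → a * ≤ b * → b ≤ a
  *-reflecting {a} {b} h =
    subst (_≤ a) (*-involutive b) (subst ((b *) * ≤_) (*-involutive a) (*-reversing h))

  *-swapˡ : ∀ {a b} → a * ≤ b → b * ≤ a
  *-swapˡ {a} {b} h = subst (b * ≤_) (*-involutive a) (*-reversing h)

  *-swapʳ : ∀ {a b} → a ≤ b * → b ≤ a *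
  *-swapʳ {a} {b} h = subst (_≤ a *) (*-involutive b) (*-reversing h)

  module _ (regular : Regular S) where

    ¬co-small : ∀ {a} → ¬ (a * ≤ a)
    ¬co-small {a} h = regular (a *) (subst (a * ≤_) (sym (*-involutive a)) h)

    -- In a regular system, if a* ≤ b then a and b are incomparable:
    -- a ≤ b would give b* ≤ a* ≤ b and b ≤ a would give a* ≤ b ≤ a.
    star-below⇒incomparable : ∀ {a b} → a * ≤ b → ¬ Comparable S a b
    star-below⇒incomparable h (inj₁ a≤b) = ¬co-small (≤-trans (*-reversing a≤b) h)
    star-below⇒incomparable h (inj₂ b≤a) = ¬co-small (≤-trans h b≤a)

    -- Then no x ∈ X lies below y* for y ∈ X: the
    -- pair x < y* would witness an inconsistency of X*, since x and y* are
    -- orientations of different separations (x = y* contradicts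
    -- antisymmetry, x = y would make x small).
    consistent⇒¬below-star :
      ∀ {ℓx} (X : Pred Carrier ℓx) → (∀ a → ¬ Degenerate S a) →
      Antisymmetric S X → Consistent S (Star S X) →
      ∀ {x y} → X x → X y → ¬ (x ≤ y *)
    consistent⇒¬below-star X nondegenerate antisymmetric consistent {x} {y} x∈X y∈X x≤y* =
      consistent x (y *) different-separations (x≤y* , x≢y*) (x , x∈X , refl) (y , y∈X , refl)
      where
      x≢y* : ¬ (x ≡ y *)
      x≢y* x≡y* = nondegenerate y (antisymmetric y y∈X (subst X x≡y* x∈X))
      different-separations : ¬ SameSep S x (y *)
      different-separations (inj₁ x≡y*) = x≢y* x≡y*
      different-separations (inj₂ x≡y**) =
        regular x (subst (λ z → x ≤ z *) (sym (trans x≡y** (*-involutive y))) x≤y*)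

  nested⇒star-below : Nested S → ∀ {a b} →
    ¬ Comparable S a b → ¬ (a ≤ b *) → ¬ (b ≤ a *) → a * ≤ b
  nested⇒star-below nested {a} {b} incomparable ¬a≤b* ¬b≤a* with nested a b
  ... | inj₁ a~b                     = ⊥-elim (incomparable a~b)
  ... | inj₂ (inj₁ (inj₁ a≤b*))      = ⊥-elim (¬a≤b* a≤b*)
  ... | inj₂ (inj₁ (inj₂ b*≤a))      = *-swapˡ b*≤a
  ... | inj₂ (inj₂ (inj₁ (inj₁ h)))  = h
  ... | inj₂ (inj₂ (inj₁ (inj₂ b≤a*))) = ⊥-elim (¬b≤a* b≤a*)
  ... | inj₂ (inj₂ (inj₂ (inj₁ h)))  = ⊥-elim (incomparable (inj₂ (*-reflecting h)))
  ... | inj₂ (inj₂ (inj₂ (inj₂ h)))  = ⊥-elim (incomparable (inj₁ (*-reflecting h)))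

lemma4p2 : {c ℓ ℓx : Level} (S : SepSys c ℓ) → Regular S → TreeSet S →
    (X : Pred (SepSys.Carrier S) ℓx) →
    Antisymmetric S X → IsOrderTree S X → Consistent S (Star S X) →
    ((p q : τElt S X) → (SepSys._≤_ S (embed S X p) (embed S X q) ⇔ τ≤ S X p q))
    × ((p : τElt S X) → embed S X (τ* S X p) ≡ SepSys._* S (embed S X p))
lemma4p2 S regular (nested , (_ , nondegenerate)) X antisymmetric _ consistent =
  same-order , same-involution
  where
  open SepSys S
  open SeparationFacts S

  ¬below-star : ∀ {x y} → X x → X y → ¬ (x ≤ y *)
  ¬below-star = consistent⇒¬below-star regular X nondegenerate antisymmetric consistent

  same-order : (p q : τElt S X) → (embed S X p ≤ embed S X q) ⇔ τ≤ S X p q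
  same-order (inj₁ x) (inj₁ y) = mk⇔ lift lower
  same-order (inj₂ x) (inj₂ y) = mk⇔ (λ h → lift (*-reflecting h)) (λ h → *-reversing (lower h))
  same-order (inj₁ (x , x∈X)) (inj₂ (y , y∈X)) =
    mk⇔ (λ h → ⊥-elim (¬below-star x∈X y∈X h)) (λ h → ⊥-elim (lower h))
  same-order (inj₂ (x , x∈X)) (inj₁ (y , y∈X)) =
    mk⇔ (λ h → lift (star-below⇒incomparable regular h))
        (λ h → nested⇒star-below nested (lower h) (¬below-star x∈X y∈X) (¬below-star y∈X x∈X))

  same-involution : (p : τElt S X) → embed S X (τ* S X p) ≡ embed S X p *
  same-involution (inj₁ x) = refl
  same-involution (inj₂ x) = sym (*-involutive (proj₁ x))
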